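{- (Local Discharging Lemma.) Let $S$ be a finite nonempty set of positive integers and fix integers $a,b,t\ge1$ and $c\ge0$. Let $X$ be a nonempty periodic independent set of $G(S)$, with blocks $B_i$ ($i\in\mathbb{Z}$) and $t$-frames $F_j$ ($j\in\mathbb{Z}$) as defined in the context. Initialize the charge $\mu(B_i)=a|B_i|-b$. Let $d$ be an $S$-local first-stage discharging rule, defining $\mu^*(B_i)=\mu(B_i)+\sum_{j\in\mathbb{Z}}d(B_j,B_i)$; set $\nu^*(F_j)=\sum_{i=j}^{j+t-1}\mu^*(B_i)$; let $d'$ be an $S$-local second-stage discharging rule, defining $\nu'(F_j)=\nu^*(F_j)+\sum_{i\in\mathbb{Z}}d'(F_i,F_j)$. If $\nu'(F_j)\ge c$ for all $j\in\mathbb{Z}$, then $\delta(X)\le\frac{at}{bt+c}$.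
   Context: The distance graph $G(S)$ has vertex set $\mathbb{Z}$, with $i,j$ adjacent iff $|i-j|\in S$; $\delta(A)=\limsup_{N\to\infty}\frac{|A\cap[-N,N]|}{2N+1}$; $X$ is periodic if $X+p=X$ for some $p\ge1$. Index the elements of $X$ increasingly as $X=\{\dots<x_{ -1}<x_0<x_1<\dots\}$. The $i$th block is $B_i=\{x_i,x_i+1,\dots,x_{i+1}-1\}$, so $|B_i|=x_{i+1}-x_i$. The $j$th frame of length $t$ is $F_j=(B_j,B_{j+1},\dots,B_{j+t-1})$. A first-stage discharging rule is a function $d$ assigning an integer $d(B_i,B_j)$ to each ordered pair of blocks with $d(B_i,B_j)=-d(B_j,B_i)$; it is $S$-local if there is an integer $m=m(S)$ such that $d(B_i,B_j)=0$ whenever $|x_i-x_j|>m$, and when $|x_i-x_j|\le m$, $d(B_i,B_j)$ is determined (by a fixed rule, together with the relative position of $B_j$) by the sequence of block sizes $|B_{i-m}|,\dots,|B_{i+m}|$. A second-stage discharging rule is a function $d'$ assigning an integer $d'(F_i,F_j)$ to each ordered pair of frames with $d'(F_i,F_j)=-d'(F_j,F_i)$; it is $S$-local if there is an integer $m'=m'(S)$ such that $d'(F_i,F_j)=0$ whenever $|i-j|>m'$, and when $|i-j|\le m'$, $d'(F_i,F_j)$ is determined (together with $j-i$) by the block sizes of the frames $F_{i-m'},\dots,F_{i+m'}$. -}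

module Defs where

open import Data.Nat as ℕ using (ℕ; zero; suc)
open import Data.Integer as ℤ using (ℤ; +_; ∣_∣)
open import Data.Rational as ℚ using (ℚ)
open import Data.Bool using (Bool; true; false; if_then_else_)
open import Data.List using (List; []; _∷_; map; upTo)
open import Data.Nat.ListAction using (sum)
open import Data.List.Membership.Propositional using (_∈_)
open import Data.Product using (Σ; _×_; _,_)
open import Relation.Binary.PropositionalEquality using (_≡_)
open import Relation.Nullary using (¬_)

Subsetℤ : Set
Subsetℤ = ℤ → Bool

FinPosSet : List ℕ → Set
FinPosSet S = (Σ ℕ λ s → s ∈ S) × (∀ s → s ∈ S → 1 ℕ.≤ s)

NonemptySet : Subsetℤ → Set
NonemptySet X = Σ ℤ λ z → X z ≡ true

Periodic : Subsetℤ → Set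
Periodic X = Σ ℕ λ p → (1 ℕ.≤ p) × (∀ z → X (z ℤ.+ + p) ≡ X z)

IndependentIn : List ℕ → Subsetℤ → Set
IndependentIn S X = ∀ i j → X i ≡ true → X j ≡ true → ¬ (∣ i ℤ.- j ∣ ∈ S)

IncreasingIndexing : Subsetℤ → (ℤ → ℤ) → Set
IncreasingIndexing X x =
  (∀ i → x i ℤ.< x (i ℤ.+ + 1)) ×
  (∀ i → X (x i) ≡ true) ×
  (∀ z → X z ≡ true → Σ ℤ λ i → x i ≡ z)

blockSize : (ℤ → ℤ) → ℤ → ℤ
blockSize x i = x (i ℤ.+ + 1) ℤ.- x i

rangeℤ : ℕ → List ℤ
rangeℤ m = map (λ k → + k ℤ.- + m) (upTo (suc (2 ℕ.* m)))

sumℤ : List ℤ → ℤ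
sumℤ [] = + 0
sumℤ (z ∷ zs) = z ℤ.+ sumℤ zs

ΣWin : ℕ → (ℤ → ℤ) → ℤ
ΣWin m f = sumℤ (map f (rangeℤ m))

blockWindow : (ℤ → ℤ) → ℕ → ℤ → List ℤ
blockWindow x m i = map (λ k → blockSize x (i ℤ.+ k)) (rangeℤ m)

frameSizes : (ℤ → ℤ) → ℕ → ℤ → List ℤ
frameSizes x t j = map (λ l → blockSize x (j ℤ.+ + l)) (upTo t)

frameWindow : (ℤ → ℤ) → ℕ → ℕ → ℤ → List (List ℤ)
frameWindow x t m' i = map (λ k → frameSizes x t (i ℤ.+ k)) (rangeℤ m')

-- d (i , j) stands for d(B_i , B_j)
Antisymmetric : (ℤ → ℤ → ℤ) → Set
Antisymmetric d = ∀ i j → d i j ≡ ℤ.- d j i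

LocalFirstStage : (ℤ → ℤ) → (ℤ → ℤ → ℤ) → ℕ → Set
LocalFirstStage x d m =
  (∀ i j → m ℕ.< ∣ x i ℤ.- x j ∣ → d i j ≡ + 0) ×
  (Σ (List ℤ → ℤ → ℤ) λ R →
     ∀ i j → ∣ x i ℤ.- x j ∣ ℕ.≤ m → d i j ≡ R (blockWindow x m i) (j ℤ.- i))

-- d' (i , j) stands for d'(F_i , F_j); S-local with locality constant m'
LocalSecondStage : (ℤ → ℤ) → ℕ → (ℤ → ℤ → ℤ) → ℕ → Set
LocalSecondStage x t d' m' =
  (∀ i j → m' ℕ.< ∣ i ℤ.- j ∣ → d' i j ≡ + 0) ×
  (Σ (List (List ℤ) → ℤ → ℤ) λ R →
     ∀ i j → ∣ i ℤ.- j ∣ ℕ.≤ m' → d' i j ≡ R (frameWindow x t m' i) (j ℤ.- i))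

μ : ℕ → ℕ → (ℤ → ℤ) → ℤ → ℤ
μ a b x i = + a ℤ.* blockSize x i ℤ.- + b

-- μ*(B_i) = μ(B_i) + Σ_j d(B_j,B_i); only j with |j - i| ≤ m can contribute
μ* : ℕ → ℕ → (ℤ → ℤ) → (ℤ → ℤ → ℤ) → ℕ → ℤ → ℤ
μ* a b x d m i = μ a b x i ℤ.+ ΣWin m (λ k → d (i ℤ.+ k) i)

ν* : ℕ → ℕ → ℕ → (ℤ → ℤ) → (ℤ → ℤ → ℤ) → ℕ → ℤ → ℤ
ν* a b t x d m j = sumℤ (map (λ l → μ* a b x d m (j ℤ.+ + l)) (upTo t))

-- ν'(F_j) = ν*(F_j) + Σ_i d'(F_i,F_j); only i with |i - j| ≤ m' can contribute
ν' : ℕ → ℕ → ℕ → (ℤ → ℤ) → (ℤ → ℤ → ℤ) → ℕ → (ℤ → ℤ → ℤ) → ℕ → ℤ → ℤ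
ν' a b t x d m d' m' j = ν* a b t x d m j ℤ.+ ΣWin m' (λ k → d' (j ℤ.+ k) j)

countX : Subsetℤ → ℕ → ℕ
countX X N = sum (map (λ k → if X (+ k ℤ.- + N) then 1 else 0) (upTo (suc (2 ℕ.* N))))

-- n / d as a rational (d = 0 gives 0; only used with d ≥ 1)
_/ℕ_ : ℕ → ℕ → ℚ
n /ℕ zero = ℚ.0ℚ
n /ℕ suc d = + n ℚ./ suc d

-- δ(X) ≤ r, i.e. limsup_N |X ∩ [-N,N]|/(2N+1) ≤ r
DensityAtMost : Subsetℤ → ℚ → Set
DensityAtMost X r =
  ∀ (ε : ℚ) → ℚ.Positive ε →
    Σ ℕ λ N₀ → ∀ N → N₀ ℕ.≤ N →
      (countX X N /ℕ suc (2 ℕ.* N)) ℚ.≤ r ℚ.+ ε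

-- A period p of X shifts the indexing: x (i + n) = x i + p, where n is the number of
-- elements of X in a period. Local rules only see block sizes, so both discharging
-- rules are invariant under this shift; being antisymmetric, the charge they move
-- cancels over a period. Summing ν' ≥ c over n consecutive frames therefore gives
-- n c ≤ t (a p - n b), i.e. n / p ≤ a t / (b t + c), and n / p is the density of X.
module Submission where

open import Defs
open import Function using (_∘_; id)
open import Data.Bool using (Bool; true; false; if_then_else_)
open import Data.Empty using (⊥-elim)
open import Data.Product using (Σ; _×_; _,_; proj₁; proj₂)
open import Data.Nat as ℕ using (ℕ; zero; suc)
import Data.Nat.Properties as ℕ
open import Data.Nat.DivMod using (_/_; _%_; m≡m%n+[m/n]*n; m%n<n; m/n*n≤m)
open import Data.Nat.ListAction using (sum)
open import Data.Nat.Tactic.RingSolver using () renaming (solve-∀ to ℕ-solve-∀)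
open import Data.Integer as ℤ using (ℤ; +_; -[1+_]; ∣_∣; _+_; _-_; _*_; -_; _≤_; _<_)
import Data.Integer.Properties as ℤ
open import Data.Integer.Tactic.RingSolver using (solve-∀)
open import Data.Rational as ℚ using (ℚ; mkℚ)
import Data.Rational.Properties as ℚ
import Data.Rational.Unnormalised as ℚᵘ
import Data.Rational.Unnormalised.Properties as ℚᵘ
open import Data.List using (List; []; _∷_; map; upTo; applyUpTo)
open import Data.List.Properties using (map-applyUpTo; map-cong)
open import Algebra.Properties.CommutativeSemigroup ℤ.+-commutativeSemigroup
  using () renaming (interchange to +-interchange)
open import Algebra.Properties.AbelianGroup ℤ.+-0-abelianGroup
  using () renaming (∙-cancelˡ to +-cancelˡ)
open import Relation.Nullary using (¬_; yes; no)
open import Relation.Binary.PropositionalEquality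

∑< : ℕ → (ℕ → ℤ) → ℤ
∑< zero    f = + 0
∑< (suc n) f = f 0 + ∑< n (f ∘ suc)

syntax ∑< n (λ i → e) = ∑[ i < n ] e

sumℤ-map-applyUpTo : ∀ {A : Set} (f : A → ℤ) (g : ℕ → A) n →
  sumℤ (map f (applyUpTo g n)) ≡ ∑[ i < n ] f (g i)
sumℤ-map-applyUpTo f g zero    = refl
sumℤ-map-applyUpTo f g (suc n) = cong (_+_ (f (g 0))) (sumℤ-map-applyUpTo f (g ∘ suc) n)

sumℤ-map-upTo : ∀ (f : ℕ → ℤ) n → sumℤ (map f (upTo n)) ≡ ∑[ i < n ] f i
sumℤ-map-upTo f = sumℤ-map-applyUpTo f id

∑-cong-< : ∀ {f g : ℕ → ℤ} n → (∀ i → i ℕ.< n → f i ≡ g i) → ∑< n f ≡ ∑< n g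
∑-cong-< zero    eq = refl
∑-cong-< (suc n) eq = cong₂ _+_ (eq 0 ℕ.z<s) (∑-cong-< n (λ i i<n → eq (suc i) (ℕ.s<s i<n)))

∑-cong : ∀ {f g : ℕ → ℤ} n → (∀ i → f i ≡ g i) → ∑< n f ≡ ∑< n g
∑-cong n eq = ∑-cong-< n (λ i _ → eq i)

∑-const : ∀ (c : ℤ) n → ∑[ i < n ] c ≡ + n * c
∑-const c zero    = sym (ℤ.*-zeroˡ c)
∑-const c (suc n) = trans (cong (_+_ c) (∑-const c n)) (suc-* c (+ n))
  where
  suc-* : ∀ c m → c + m * c ≡ (+ 1 + m) * c
  suc-* = solve-∀

∑-distrib-+ : ∀ (f g : ℕ → ℤ) n → ∑[ i < n ] (f i + g i) ≡ ∑< n f + ∑< n g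
∑-distrib-+ f g zero    = refl
∑-distrib-+ f g (suc n) =
  trans (cong (_+_ (f 0 + g 0)) (∑-distrib-+ (f ∘ suc) (g ∘ suc) n))
        (+-interchange (f 0) (g 0) _ _)

∑-distribˡ-* : ∀ (c : ℤ) (f : ℕ → ℤ) n → ∑[ i < n ] (c * f i) ≡ c * ∑< n f
∑-distribˡ-* c f zero    = sym (ℤ.*-zeroʳ c)
∑-distribˡ-* c f (suc n) =
  trans (cong (_+_ (c * f 0)) (∑-distribˡ-* c (f ∘ suc) n))
        (sym (ℤ.*-distribˡ-+ c (f 0) _))

∑-neg : ∀ (f : ℕ → ℤ) n → ∑[ i < n ] (- f i) ≡ - ∑< n f
∑-neg f zero    = refl
∑-neg f (suc n) =
  trans (cong (_+_ (- f 0)) (∑-neg (f ∘ suc) n)) (sym (ℤ.neg-distrib-+ (f 0) _))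

∑-suc : ∀ (f : ℕ → ℤ) n → ∑< (suc n) f ≡ ∑< n f + f n
∑-suc f zero    = ℤ.+-comm (f 0) (+ 0)
∑-suc f (suc n) =
  trans (cong (_+_ (f 0)) (∑-suc (f ∘ suc) n)) (sym (ℤ.+-assoc (f 0) _ _))

∑-+ : ∀ (f : ℕ → ℤ) m n → ∑< (m ℕ.+ n) f ≡ ∑< m f + ∑[ i < n ] f (m ℕ.+ i)
∑-+ f zero    n = sym (ℤ.+-identityˡ _)
∑-+ f (suc m) n =
  trans (cong (_+_ (f 0)) (∑-+ (f ∘ suc) m n)) (sym (ℤ.+-assoc (f 0) _ _))

∑-comm : ∀ (f : ℕ → ℕ → ℤ) m n → ∑[ i < m ] ∑[ j < n ] f i j ≡ ∑[ j < n ] ∑[ i < m ] f i j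
∑-comm f zero    n = sym (trans (∑-const (+ 0) n) (ℤ.*-zeroʳ (+ n)))
∑-comm f (suc m) n =
  trans (cong (_+_ (∑< n (f 0))) (∑-comm (f ∘ suc) m n))
        (sym (∑-distrib-+ (f 0) (λ j → ∑[ i < m ] f (suc i) j) n))

∑-mono-≤ : ∀ {f g : ℕ → ℤ} n → (∀ i → f i ≤ g i) → ∑< n f ≤ ∑< n g
∑-mono-≤ zero    f≤g = ℤ.≤-refl
∑-mono-≤ (suc n) f≤g = ℤ.+-mono-≤ (f≤g 0) (∑-mono-≤ n (f≤g ∘ suc))

∑-telescope : ∀ (h : ℕ → ℤ) n → ∑[ i < n ] (h (suc i) - h i) ≡ h n - h 0
∑-telescope h zero    = sym (ℤ.+-inverseʳ (h 0))
∑-telescope h (suc n) = begin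
  ∑[ i < suc n ] (h (suc i) - h i)  ≡⟨ ∑-suc _ n ⟩
  ∑[ i < n ] (h (suc i) - h i) + (h (suc n) - h n)
    ≡⟨ cong (_+ (h (suc n) - h n)) (∑-telescope h n) ⟩
  (h n - h 0) + (h (suc n) - h n)   ≡⟨ telescope-step (h n) (h 0) (h (suc n)) ⟩
  h (suc n) - h 0                   ∎
  where
  open ≡-Reasoning
  telescope-step : ∀ a b c → (a - b) + (c - a) ≡ c - b
  telescope-step = solve-∀

ℤ-induction : (P : ℤ → Set) → P (+ 0) →
  (∀ i → P i → P (i + + 1)) → (∀ i → P (i + + 1) → P i) → ∀ i → P i
ℤ-induction P P0 up down (+ n)    = nonneg n
  where
  nonneg : ∀ n → P (+ n)
  nonneg zero    = P0
  nonneg (suc n) = subst P (cong +_ (ℕ.+-comm n 1)) (up (+ n) (nonneg n))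
ℤ-induction P P0 up down -[1+ n ] = neg n
  where
  neg : ∀ n → P -[1+ n ]
  neg zero    = down -[1+ 0 ] P0
  neg (suc n) = down -[1+ suc n ] (neg n)

step-invariant⇒constant : ∀ {A : Set} (h : ℤ → A) →
  (∀ z → h (z + + 1) ≡ h z) → ∀ z → h z ≡ h (+ 0)
step-invariant⇒constant h step =
  ℤ-induction (λ z → h z ≡ h (+ 0)) refl
    (λ z hz≡h0 → trans (step z) hz≡h0) (λ z hz+1≡h0 → trans (sym (step z)) hz+1≡h0)

∑-periodic-shift : ∀ (f : ℤ → ℤ) n → (∀ z → f (z + + n) ≡ f z) →
  ∀ z → ∑[ i < n ] f (z + + i) ≡ ∑[ i < n ] f (+ i)
∑-periodic-shift f n f-periodic = step-invariant⇒constant window step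
  where
  window : ℤ → ℤ
  window z = ∑[ i < n ] f (z + + i)
  step : ∀ z → window (z + + 1) ≡ window z
  step z = +-cancelˡ (f z) _ _ (begin
    f z + window (z + + 1)
      ≡⟨ cong₂ _+_ (cong f (sym (ℤ.+-identityʳ z)))
                   (∑-cong n (λ i → cong f (ℤ.+-assoc z (+ 1) (+ i)))) ⟩
    ∑[ i < suc n ] f (z + + i)         ≡⟨ ∑-suc _ n ⟩
    window z + f (z + + n)             ≡⟨ cong (_+_ (window z)) (f-periodic z) ⟩
    window z + f z                     ≡⟨ ℤ.+-comm (window z) (f z) ⟩
    f z + window z                     ∎)
    where open ≡-Reasoning

ΣWin-as-∑ : ∀ m (g : ℤ → ℤ) → ΣWin m g ≡ ∑[ k < suc (2 ℕ.* m) ] g (+ k - + m)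
ΣWin-as-∑ m g = trans (cong (sumℤ ∘ map g) (map-applyUpTo id (λ k → + k - + m) (suc (2 ℕ.* m))))
                      (sumℤ-map-applyUpTo g (λ k → + k - + m) (suc (2 ℕ.* m)))

self-negative⇒0 : ∀ a → a ≡ - a → a ≡ + 0
self-negative⇒0 (+ zero)  _  = refl
self-negative⇒0 ℤ.+[1+ _ ] ()
self-negative⇒0 -[1+ _ ]  ()

ΣWin-odd : ∀ (g : ℤ → ℤ) → (∀ k → g (- k) ≡ - g k) → ∀ m → ΣWin m g ≡ + 0
ΣWin-odd g g-odd m = trans (ΣWin-as-∑ m g) (window m)
  where
  open ≡-Reasoning
  shift-index : ∀ a b → (+ 1 + a) - (+ 1 + b) ≡ a - b
  shift-index = solve-∀
  cancel : ∀ a → - a + (+ 0 + a) ≡ + 0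
  cancel = solve-∀
  last-index : ∀ m → + suc (suc (2 ℕ.* m)) - + suc m ≡ + suc m
  last-index m = begin
    + suc (suc (2 ℕ.* m)) - + suc m  ≡⟨ cong (λ L → + L - + suc m) (2+2*m≡[1+m]+[1+m] m) ⟩
    + (suc m ℕ.+ suc m) - + suc m    ≡⟨ cong (_- + suc m) (ℤ.pos-+ (suc m) (suc m)) ⟩
    + suc m + + suc m - + suc m      ≡⟨ add-sub (+ suc m) ⟩
    + suc m                          ∎
    where
    2+2*m≡[1+m]+[1+m] : ∀ m → suc (suc (2 ℕ.* m)) ≡ suc m ℕ.+ suc m
    2+2*m≡[1+m]+[1+m] = ℕ-solve-∀
    add-sub : ∀ a → a + a - a ≡ a
    add-sub = solve-∀
  window : ∀ m → ∑[ k < suc (2 ℕ.* m) ] g (+ k - + m) ≡ + 0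
  window zero    = trans (ℤ.+-identityʳ _) (self-negative⇒0 _ (g-odd (+ 0)))
  window (suc m) = begin
    ∑[ k < suc (2 ℕ.* suc m) ] g (+ k - + suc m)
      ≡⟨ cong (λ L → ∑[ k < suc L ] g (+ k - + suc m)) (ℕ.*-suc 2 m) ⟩
    g (- + suc m) + ∑[ k < suc (suc (2 ℕ.* m)) ] g (+ suc k - + suc m)
      ≡⟨ cong (_+_ (g (- + suc m))) (∑-suc (λ k → g (+ suc k - + suc m)) (suc (2 ℕ.* m))) ⟩
    g (- + suc m) + (∑[ k < suc (2 ℕ.* m) ] g (+ suc k - + suc m)
                      + g (+ suc (suc (2 ℕ.* m)) - + suc m))
      ≡⟨ cong₂ (λ u v → g (- + suc m) + (u + g v))
               (trans (∑-cong (suc (2 ℕ.* m)) (λ k → cong g (shift-index (+ k) (+ m)))) (window m))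
               (last-index m) ⟩
    g (- + suc m) + (+ 0 + g (+ suc m))
      ≡⟨ cong (_+ (+ 0 + g (+ suc m))) (g-odd (+ suc m)) ⟩
    - g (+ suc m) + (+ 0 + g (+ suc m))
      ≡⟨ cancel (g (+ suc m)) ⟩
    + 0 ∎

periodic-transfers-cancel : ∀ (D : ℤ → ℤ → ℤ) → Antisymmetric D → ∀ n →
  (∀ i j → D (i + + n) (j + + n) ≡ D i j) →
  ∀ m → ∑[ i < n ] ΣWin m (λ k → D (+ i + k) (+ i)) ≡ + 0
periodic-transfers-cancel D D-anti n D-periodic m = begin
  ∑[ i < n ] ΣWin m (λ k → D (+ i + k) (+ i))
    ≡⟨ ∑-cong n (λ i → ΣWin-as-∑ m (λ k → D (+ i + k) (+ i))) ⟩
  ∑[ i < n ] ∑[ k < suc (2 ℕ.* m) ] D (+ i + (+ k - + m)) (+ i)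
    ≡⟨ ∑-comm (λ i k → D (+ i + (+ k - + m)) (+ i)) n (suc (2 ℕ.* m)) ⟩
  ∑[ k < suc (2 ℕ.* m) ] received (+ k - + m)
    ≡⟨ ΣWin-as-∑ m received ⟨
  ΣWin m received
    ≡⟨ ΣWin-odd received received-odd m ⟩
  + 0 ∎
  where
  open ≡-Reasoning
  received : ℤ → ℤ
  received κ = ∑[ i < n ] D (+ i + κ) (+ i)
  -- Periodicity lets the sum over a period be shifted by κ; antisymmetry then flips the sign.
  received-odd : ∀ κ → received (- κ) ≡ - received κ
  received-odd κ = begin
    ∑[ i < n ] D (+ i - κ) (+ i)
      ≡⟨ ∑-periodic-shift (λ z → D (z - κ) z) n
           (λ z → trans (cong (λ w → D w (z + + n)) (reorder z (+ n) κ)) (D-periodic (z - κ) z)) κ ⟨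
    ∑[ i < n ] D (κ + + i - κ) (κ + + i)
      ≡⟨ ∑-cong n (λ i → trans (D-anti _ _) (cong₂ (λ u v → - D u v) (ℤ.+-comm κ (+ i)) (cancel κ (+ i)))) ⟩
    ∑[ i < n ] (- D (+ i + κ) (+ i))
      ≡⟨ ∑-neg (λ i → D (+ i + κ) (+ i)) n ⟩
    - received κ ∎
    where
    reorder : ∀ z n κ → z + n - κ ≡ (z - κ) + n
    reorder = solve-∀
    cancel : ∀ κ i → κ + i - κ ≡ i
    cancel = solve-∀

∑-+-periodic-transfers : ∀ (f : ℕ → ℤ) (D : ℤ → ℤ → ℤ) → Antisymmetric D → ∀ n →
  (∀ i j → D (i + + n) (j + + n) ≡ D i j) →
  ∀ m → ∑[ i < n ] (f i + ΣWin m (λ k → D (+ i + k) (+ i))) ≡ ∑< n f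
∑-+-periodic-transfers f D D-anti n D-periodic m = begin
  ∑[ i < n ] (f i + ΣWin m (λ k → D (+ i + k) (+ i)))
    ≡⟨ ∑-distrib-+ f (λ i → ΣWin m (λ k → D (+ i + k) (+ i))) n ⟩
  ∑< n f + ∑[ i < n ] ΣWin m (λ k → D (+ i + k) (+ i))
    ≡⟨ cong (_+_ (∑< n f)) (periodic-transfers-cancel D D-anti n D-periodic m) ⟩
  ∑< n f + + 0
    ≡⟨ ℤ.+-identityʳ (∑< n f) ⟩
  ∑< n f ∎
  where open ≡-Reasoning

i<j⇒∃[k]j≡i+[1+k] : ∀ {i j} → i < j → Σ ℕ λ k → j ≡ i + + suc k
i<j⇒∃[k]j≡i+[1+k] {i} {j} i<j = ∣ j - (+ 1 + i) ∣ , (begin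
  j                             ≡⟨ split j i ⟩
  i + (+ 1 + (j - (+ 1 + i)))   ≡⟨ cong (λ w → i + (+ 1 + w)) (ℤ.0≤i⇒+∣i∣≡i 0≤j-[1+i]) ⟨
  i + + suc ∣ j - (+ 1 + i) ∣   ∎)
  where
  open ≡-Reasoning
  0≤j-[1+i] : + 0 ≤ j - (+ 1 + i)
  0≤j-[1+i] = ℤ.i≤j⇒0≤j-i (ℤ.i<j⇒suc[i]≤j i<j)
  split : ∀ j i → j ≡ i + (+ 1 + (j - (+ 1 + i)))
  split = solve-∀

i<i+[1+k] : ∀ i k → i < i + + suc k
i<i+[1+k] i k = subst (_< i + + suc k) (ℤ.+-identityʳ i) (ℤ.+-monoʳ-< i (ℤ.+<+ ℕ.z<s))

i<j⇒i+1≤j : ∀ {i j} → i < j → i + + 1 ≤ j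
i<j⇒i+1≤j {i} i<j = subst (_≤ _) (ℤ.+-comm (+ 1) i) (ℤ.i<j⇒suc[i]≤j i<j)

module StrictlyIncreasing (x : ℤ → ℤ) (x-step : ∀ i → x i < x (i + + 1)) where

  x-<-+suc : ∀ i k → x i < x (i + + suc k)
  x-<-+suc i zero    = x-step i
  x-<-+suc i (suc k) = ℤ.<-trans (x-step i)
    (subst (λ w → x (i + + 1) < x w) (ℤ.+-assoc i (+ 1) (+ suc k)) (x-<-+suc (i + + 1) k))

  x-mono-< : ∀ {i j} → i < j → x i < x j
  x-mono-< {i} i<j with i<j⇒∃[k]j≡i+[1+k] i<j
  ... | k , refl = x-<-+suc i k

  x-mono-≤ : ∀ {i j} → i ≤ j → x i ≤ x j
  x-mono-≤ {i} {j} i≤j with i ℤ.≟ j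
  ... | yes refl = ℤ.≤-refl
  ... | no  i≢j  = ℤ.<⇒≤ (x-mono-< (ℤ.≤∧≢⇒< i≤j i≢j))

  x-cancel-< : ∀ {i j} → x i < x j → i < j
  x-cancel-< xi<xj = ℤ.≰⇒> (λ j≤i → ℤ.<⇒≱ xi<xj (x-mono-≤ j≤i))

  x-cancel-≤ : ∀ {i j} → x i ≤ x j → i ≤ j
  x-cancel-≤ xi≤xj = ℤ.≮⇒≥ (λ j<i → ℤ.<⇒≱ (x-mono-< j<i) xi≤xj)

module IncreasingIndexingOf {X : Subsetℤ} {x : ℤ → ℤ} (x-indexes-X : IncreasingIndexing X x) where

  x-step : ∀ i → x i < x (i + + 1)
  x-step = proj₁ x-indexes-X

  x∈X : ∀ i → X (x i) ≡ true
  x∈X = proj₁ (proj₂ x-indexes-X)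

  x-onto : ∀ z → X z ≡ true → Σ ℤ λ i → x i ≡ z
  x-onto = proj₂ (proj₂ x-indexes-X)

  open StrictlyIncreasing x x-step public

  next-least : ∀ i z → X z ≡ true → x i < z → x (i + + 1) ≤ z
  next-least i z z∈X xi<z with x-onto z z∈X
  ... | k , refl = x-mono-≤ (i<j⇒i+1≤j (x-cancel-< xi<z))

  previous-greatest : ∀ i z → X z ≡ true → z < x (i + + 1) → z ≤ x i
  previous-greatest i z z∈X z<next = ℤ.≮⇒≥ (λ xi<z → ℤ.<⇒≱ z<next (next-least i z z∈X xi<z))

  gap-empty : ∀ i z → x i < z → z < x (i + + 1) → ¬ X z ≡ true
  gap-empty i z xi<z z<next z∈X = ℤ.<⇒≱ z<next (next-least i z z∈X xi<z)

IncreasingIndexing-unique : ∀ {X x y} → IncreasingIndexing X x → IncreasingIndexing X y →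
  x (+ 0) ≡ y (+ 0) → ∀ i → x i ≡ y i
IncreasingIndexing-unique {X} {x} {y} x-indexes-X y-indexes-X x0≡y0 =
  ℤ-induction (λ i → x i ≡ y i) x0≡y0 up down
  where
  module Ix = IncreasingIndexingOf x-indexes-X
  module Iy = IncreasingIndexingOf y-indexes-X
  up : ∀ i → x i ≡ y i → x (i + + 1) ≡ y (i + + 1)
  up i xi≡yi = ℤ.≤-antisym
    (Ix.next-least i _ (Iy.x∈X (i + + 1)) (subst (_< _) (sym xi≡yi) (Iy.x-step i)))
    (Iy.next-least i _ (Ix.x∈X (i + + 1)) (subst (_< _) xi≡yi (Ix.x-step i)))
  down : ∀ i → x (i + + 1) ≡ y (i + + 1) → x i ≡ y i
  down i next≡ = ℤ.≤-antisym
    (Iy.previous-greatest i _ (Ix.x∈X i) (subst (_ <_) next≡ (Ix.x-step i)))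
    (Ix.previous-greatest i _ (Iy.x∈X i) (subst (_ <_) (sym next≡) (Iy.x-step i)))

-- x (· + n) - p is another increasing indexing of X, agreeing with x at 0.
index-period : ∀ {X x} → IncreasingIndexing X x → ∀ p → (∀ z → X (z + + p) ≡ X z) →
  Σ ℕ λ n → ∀ i → x (i + + n) ≡ x i + + p
index-period {X} {x} x-indexes-X p X-periodic = n , shift
  where
  open IncreasingIndexingOf x-indexes-X
  x0+p-found : Σ ℤ λ N → x N ≡ x (+ 0) + + p
  x0+p-found = x-onto _ (trans (X-periodic (x (+ 0))) (x∈X (+ 0)))
  N : ℤ
  N = proj₁ x0+p-found
  0≤N : + 0 ≤ N
  0≤N = x-cancel-≤ (subst (x (+ 0) ≤_) (sym (proj₂ x0+p-found)) (ℤ.i≤i+j (x (+ 0)) (+ p)))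
  n : ℕ
  n = ∣ N ∣
  y : ℤ → ℤ
  y i = x (i + + n) - + p
  add-sub : ∀ a b → a + b - b ≡ a
  add-sub = solve-∀
  sub-add : ∀ a b → a - b + b ≡ a
  sub-add = solve-∀
  y-step : ∀ i → y i < y (i + + 1)
  y-step i = ℤ.+-monoˡ-< (- + p)
    (subst (λ w → x (i + + n) < x w) (reorder i (+ n) (+ 1)) (x-step (i + + n)))
    where
    reorder : ∀ i n o → i + n + o ≡ i + o + n
    reorder = solve-∀
  y∈X : ∀ i → X (y i) ≡ true
  y∈X i = trans (sym (X-periodic (y i))) (trans (cong X (sub-add _ (+ p))) (x∈X (i + + n)))
  y-onto : ∀ z → X z ≡ true → Σ ℤ λ i → y i ≡ z
  y-onto z z∈X with x-onto (z + + p) (trans (X-periodic z) z∈X)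
  ... | j , xj≡z+p = j - + n , (begin
    x (j - + n + + n) - + p  ≡⟨ cong (λ w → x w - + p) (sub-add j (+ n)) ⟩
    x j - + p                ≡⟨ cong (_- + p) xj≡z+p ⟩
    z + + p - + p            ≡⟨ add-sub z (+ p) ⟩
    z                        ∎)
    where open ≡-Reasoning
  x0≡y0 : x (+ 0) ≡ y (+ 0)
  x0≡y0 = sym (begin
    x (+ n) - + p            ≡⟨ cong (λ w → x w - + p) (ℤ.0≤i⇒+∣i∣≡i 0≤N) ⟩
    x N - + p                ≡⟨ cong (_- + p) (proj₂ x0+p-found) ⟩
    x (+ 0) + + p - + p      ≡⟨ add-sub (x (+ 0)) (+ p) ⟩
    x (+ 0)                  ∎)
    where open ≡-Reasoning
  shift : ∀ i → x (i + + n) ≡ x i + + p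
  shift i = trans (sym (sub-add _ (+ p)))
    (cong (_+ + p) (sym (IncreasingIndexing-unique x-indexes-X (y-step , y∈X , y-onto) x0≡y0 i)))

local-rule-periodic : ∀ {W : Set} (D : ℤ → ℤ → ℤ) (dist : ℤ → ℤ → ℕ) (window : ℤ → W) (m n : ℕ) →
  (∀ i j → m ℕ.< dist i j → D i j ≡ + 0) →
  (Σ (W → ℤ → ℤ) λ R → ∀ i j → dist i j ℕ.≤ m → D i j ≡ R (window i) (j - i)) →
  (∀ i j → dist (i + + n) (j + + n) ≡ dist i j) → (∀ i → window (i + + n) ≡ window i) →
  ∀ i j → D (i + + n) (j + + n) ≡ D i j
local-rule-periodic D dist window m n far (R , near) dist-periodic window-periodic i j
  with dist i j ℕ.≤? m
... | yes close = begin
  D (i + + n) (j + + n)              ≡⟨ near _ _ (subst (ℕ._≤ m) (sym (dist-periodic i j)) close) ⟩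
  R (window (i + + n)) (j + + n - (i + + n))
    ≡⟨ cong₂ R (window-periodic i) (sub-shift j i (+ n)) ⟩
  R (window i) (j - i)               ≡⟨ near i j close ⟨
  D i j                              ∎
  where
  open ≡-Reasoning
  sub-shift : ∀ j i n → j + n - (i + n) ≡ j - i
  sub-shift = solve-∀
... | no apart = trans (far _ _ (subst (m ℕ.<_) (sym (dist-periodic i j)) (ℕ.≰⇒> apart)))
                       (sym (far i j (ℕ.≰⇒> apart)))

module PeriodicBlocks (x : ℤ → ℤ) (n p : ℕ) (shift : ∀ i → x (i + + n) ≡ x i + + p) where

  private
    reorder : ∀ i n k → i + n + k ≡ i + k + n
    reorder = solve-∀
    sub-shift : ∀ a b p → a + p - (b + p) ≡ a - b
    sub-shift = solve-∀

  blockSize-periodic : ∀ i → blockSize x (i + + n) ≡ blockSize x i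
  blockSize-periodic i = begin
    x (i + + n + + 1) - x (i + + n)    ≡⟨ cong (λ w → x w - x (i + + n)) (reorder i (+ n) (+ 1)) ⟩
    x (i + + 1 + + n) - x (i + + n)    ≡⟨ cong₂ _-_ (shift (i + + 1)) (shift i) ⟩
    x (i + + 1) + + p - (x i + + p)    ≡⟨ sub-shift (x (i + + 1)) (x i) (+ p) ⟩
    x (i + + 1) - x i                  ∎
    where open ≡-Reasoning

  blockSize-shift : ∀ i k → blockSize x (i + + n + k) ≡ blockSize x (i + k)
  blockSize-shift i k = trans (cong (blockSize x) (reorder i (+ n) k)) (blockSize-periodic (i + k))

  blockWindow-periodic : ∀ m i → blockWindow x m (i + + n) ≡ blockWindow x m i
  blockWindow-periodic m i = map-cong (blockSize-shift i) (rangeℤ m)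

  frameSizes-periodic : ∀ t j → frameSizes x t (j + + n) ≡ frameSizes x t j
  frameSizes-periodic t j = map-cong (λ l → blockSize-shift j (+ l)) (upTo t)

  frameWindow-periodic : ∀ t m i → frameWindow x t m (i + + n) ≡ frameWindow x t m i
  frameWindow-periodic t m i = map-cong
    (λ k → trans (cong (frameSizes x t) (reorder i (+ n) k)) (frameSizes-periodic t (i + k)))
    (rangeℤ m)

  first-stage-periodic : ∀ d m → LocalFirstStage x d m → ∀ i j → d (i + + n) (j + + n) ≡ d i j
  first-stage-periodic d m (far , near) = local-rule-periodic d (λ i j → ∣ x i - x j ∣)
    (blockWindow x m) m n far near
    (λ i j → cong ∣_∣ (trans (cong₂ _-_ (shift i) (shift j)) (sub-shift (x i) (x j) (+ p))))
    (blockWindow-periodic m)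

  second-stage-periodic : ∀ t d' m' → LocalSecondStage x t d' m' →
    ∀ i j → d' (i + + n) (j + + n) ≡ d' i j
  second-stage-periodic t d' m' (far , near) = local-rule-periodic d' (λ i j → ∣ i - j ∣)
    (frameWindow x t m') m' n far near (λ i j → cong ∣_∣ (sub-shift i j (+ n)))
    (frameWindow-periodic t m')

  ∑-blockSize-period : ∑[ i < n ] blockSize x (+ i) ≡ + p
  ∑-blockSize-period = begin
    ∑[ i < n ] (x (+ i + + 1) - x (+ i))  ≡⟨ ∑-cong n (λ i → cong (λ k → x (+ k) - x (+ i)) (ℕ.+-comm i 1)) ⟩
    ∑[ i < n ] (x (+ suc i) - x (+ i))    ≡⟨ ∑-telescope (λ k → x (+ k)) n ⟩
    x (+ n) - x (+ 0)                     ≡⟨ cong (_- x (+ 0)) (shift (+ 0)) ⟩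
    x (+ 0) + + p - x (+ 0)               ≡⟨ add-sub (x (+ 0)) (+ p) ⟩
    + p                                   ∎
    where
    open ≡-Reasoning
    add-sub : ∀ a b → a + b - a ≡ b
    add-sub = solve-∀

  ∑-μ-period : ∀ a b → ∑[ i < n ] μ a b x (+ i) ≡ + a * + p - + n * + b
  ∑-μ-period a b = begin
    ∑[ i < n ] (+ a * blockSize x (+ i) - + b)
      ≡⟨ ∑-distrib-+ (λ i → + a * blockSize x (+ i)) (λ _ → - + b) n ⟩
    ∑[ i < n ] (+ a * blockSize x (+ i)) + ∑[ i < n ] (- + b)
      ≡⟨ cong₂ _+_ (∑-distribˡ-* (+ a) (λ i → blockSize x (+ i)) n) (∑-const (- + b) n) ⟩
    + a * ∑[ i < n ] blockSize x (+ i) + + n * - + b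
      ≡⟨ cong (λ s → + a * s + + n * - + b) ∑-blockSize-period ⟩
    + a * + p + + n * - + b
      ≡⟨ cong (_+_ (+ a * + p)) (ℤ.neg-distribʳ-* (+ n) (+ b)) ⟨
    + a * + p - + n * + b ∎
    where open ≡-Reasoning

  module Charges (a b t : ℕ)
    (d : ℤ → ℤ → ℤ) (d-anti : Antisymmetric d) (m : ℕ) (d-local : LocalFirstStage x d m)
    (d' : ℤ → ℤ → ℤ) (d'-anti : Antisymmetric d') (m' : ℕ) (d'-local : LocalSecondStage x t d' m')
    where

    μ*-periodic : ∀ i → μ* a b x d m (i + + n) ≡ μ* a b x d m i
    μ*-periodic i = cong₂ _+_ (cong (λ s → + a * s - + b) (blockSize-periodic i))
      (cong sumℤ (map-cong (λ k → trans (cong (λ w → d w (i + + n)) (reorder i (+ n) k))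
                                        (first-stage-periodic d m d-local (i + k) i))
                           (rangeℤ m)))

    ∑-μ*-period : ∑[ i < n ] μ* a b x d m (+ i) ≡ + a * + p - + n * + b
    ∑-μ*-period = trans
      (∑-+-periodic-transfers (λ i → μ a b x (+ i)) d d-anti n (first-stage-periodic d m d-local) m)
      (∑-μ-period a b)

    ∑-ν*-period : ∑[ j < n ] ν* a b t x d m (+ j) ≡ + t * (+ a * + p - + n * + b)
    ∑-ν*-period = begin
      ∑[ j < n ] ν* a b t x d m (+ j)
        ≡⟨ ∑-cong n (λ j → sumℤ-map-upTo (λ l → μ* a b x d m (+ j + + l)) t) ⟩
      ∑[ j < n ] ∑[ l < t ] μ* a b x d m (+ j + + l)
        ≡⟨ ∑-comm (λ j l → μ* a b x d m (+ j + + l)) n t ⟩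
      ∑[ l < t ] ∑[ j < n ] μ* a b x d m (+ j + + l)
        ≡⟨ ∑-cong t (λ l → trans (∑-cong n (λ j → cong (μ* a b x d m) (ℤ.+-comm (+ j) (+ l))))
                                 (∑-periodic-shift (μ* a b x d m) n μ*-periodic (+ l))) ⟩
      ∑[ l < t ] ∑[ i < n ] μ* a b x d m (+ i)
        ≡⟨ ∑-const _ t ⟩
      + t * ∑[ i < n ] μ* a b x d m (+ i)
        ≡⟨ cong (+ t *_) ∑-μ*-period ⟩
      + t * (+ a * + p - + n * + b) ∎
      where open ≡-Reasoning

    ∑-ν'-period : ∑[ j < n ] ν' a b t x d m d' m' (+ j) ≡ + t * (+ a * + p - + n * + b)
    ∑-ν'-period = trans
      (∑-+-periodic-transfers (λ j → ν* a b t x d m (+ j)) d' d'-anti n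
        (second-stage-periodic t d' m' d'-local) m')
      ∑-ν*-period

    period-charge-bound : ∀ c → (∀ j → + c ≤ ν' a b t x d m d' m' j) →
      n ℕ.* (b ℕ.* t ℕ.+ c) ℕ.≤ a ℕ.* t ℕ.* p
    period-charge-bound c c≤ν' = ℤ.drop‿+≤+ (begin
      + (n ℕ.* (b ℕ.* t ℕ.+ c))
        ≡⟨ trans (ℤ.pos-* n _) (cong (+ n *_) (trans (ℤ.pos-+ (b ℕ.* t) c)
                                                     (cong (_+ + c) (ℤ.pos-* b t)))) ⟩
      + n * (+ b * + t + + c)
        ≡⟨ distrib (+ n) (+ b) (+ t) (+ c) ⟩
      + n * + c + + n * (+ b * + t)
        ≤⟨ ℤ.+-monoˡ-≤ (+ n * (+ b * + t)) nc≤∑ν' ⟩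
      + t * (+ a * + p - + n * + b) + + n * (+ b * + t)
        ≡⟨ cancel (+ t) (+ a) (+ p) (+ n) (+ b) ⟩
      + a * + t * + p
        ≡⟨ trans (ℤ.pos-* (a ℕ.* t) p) (cong (_* + p) (ℤ.pos-* a t)) ⟨
      + (a ℕ.* t ℕ.* p) ∎)
      where
      open ℤ.≤-Reasoning
      nc≤∑ν' : + n * + c ≤ + t * (+ a * + p - + n * + b)
      nc≤∑ν' = subst₂ _≤_ (∑-const (+ c) n) ∑-ν'-period (∑-mono-≤ n (λ j → c≤ν' (+ j)))
      distrib : ∀ n b t c → n * (b * t + c) ≡ n * c + n * (b * t)
      distrib = solve-∀
      cancel : ∀ t a p n b → t * (a * p - n * b) + n * (b * t) ≡ a * t * p
      cancel = solve-∀

indicator : Bool → ℤ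
indicator b = + (if b then 1 else 0)

indicator-false : ∀ {b} → ¬ b ≡ true → indicator b ≡ + 0
indicator-false {true}  b≢true = ⊥-elim (b≢true refl)
indicator-false {false} _      = refl

count : Subsetℤ → ℤ → ℕ → ℤ
count X z L = ∑[ k < L ] indicator (X (z + + k))

count-+ : ∀ X z L r → count X z (L ℕ.+ r) ≡ count X z L + count X (z + + L) r
count-+ X z L r = trans (∑-+ _ L r) (cong (_+_ (count X z L)) (∑-cong r (λ k →
  cong (indicator ∘ X) (trans (cong (_+_ z) (ℤ.pos-+ L k)) (sym (ℤ.+-assoc z (+ L) (+ k)))))))

count-mono : ∀ X z L r → count X z L ≤ count X z (L ℕ.+ r)
count-mono X z L r = subst₂ _≤_ (ℤ.+-identityʳ _) (sym (count-+ X z L r))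
  (ℤ.+-monoʳ-≤ (count X z L)
    (subst (_≤ count X (z + + L) r) (trans (∑-const (+ 0) r) (ℤ.*-zeroʳ (+ r)))
           (∑-mono-≤ r (λ _ → ℤ.+≤+ ℕ.z≤n))))

pos-sum-map : ∀ {A : Set} (f : A → ℕ) (xs : List A) → + sum (map f xs) ≡ sumℤ (map (+_ ∘ f) xs)
pos-sum-map f []       = refl
pos-sum-map f (a ∷ xs) = trans (ℤ.pos-+ (f a) _) (cong (_+_ (+ f a)) (pos-sum-map f xs))

countX-as-count : ∀ X N → + countX X N ≡ count X (- + N) (suc (2 ℕ.* N))
countX-as-count X N = begin
  + countX X N
    ≡⟨ pos-sum-map _ (upTo (suc (2 ℕ.* N))) ⟩
  sumℤ (map (λ k → indicator (X (+ k - + N))) (upTo (suc (2 ℕ.* N))))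
    ≡⟨ sumℤ-map-upTo (λ k → indicator (X (+ k - + N))) (suc (2 ℕ.* N)) ⟩
  ∑[ k < suc (2 ℕ.* N) ] indicator (X (+ k - + N))
    ≡⟨ ∑-cong (suc (2 ℕ.* N)) (λ k → cong (indicator ∘ X) (ℤ.+-comm (+ k) (- + N))) ⟩
  count X (- + N) (suc (2 ℕ.* N)) ∎
  where open ≡-Reasoning

module Counting {X : Subsetℤ} {x : ℤ → ℤ} (x-indexes-X : IncreasingIndexing X x) where

  open IncreasingIndexingOf x-indexes-X

  count-gap : ∀ i k → x (i + + 1) ≡ x i + + suc k → count X (x i) (suc k) ≡ + 1
  count-gap i k next≡ = begin
    indicator (X (x i + + 0)) + ∑[ r < k ] indicator (X (x i + + suc r))
      ≡⟨ cong₂ _+_ (cong (indicator ∘ X) (ℤ.+-identityʳ (x i))) (∑-cong-< k empty) ⟩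
    indicator (X (x i)) + ∑[ r < k ] (+ 0)
      ≡⟨ cong₂ _+_ (cong indicator (x∈X i)) (trans (∑-const (+ 0) k) (ℤ.*-zeroʳ (+ k))) ⟩
    + 1 ∎
    where
    open ≡-Reasoning
    empty : ∀ r → r ℕ.< k → indicator (X (x i + + suc r)) ≡ + 0
    empty r r<k = indicator-false (gap-empty i _
      (i<i+[1+k] (x i) r)
      (subst (x i + + suc r <_) (sym next≡) (ℤ.+-monoʳ-< (x i) (ℤ.+<+ (ℕ.s<s r<k)))))

  count-up-to : ∀ j → Σ ℕ λ L → (x (+ j) ≡ x (+ 0) + + L) × (count X (x (+ 0)) L ≡ + j)
  count-up-to zero    = 0 , sym (ℤ.+-identityʳ _) , refl
  count-up-to (suc j) with count-up-to j | i<j⇒∃[k]j≡i+[1+k] (x-step (+ j))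
  ... | L , xj≡ , count≡j | k , next≡ = L ℕ.+ suc k , x[1+j]≡ , count≡1+j
    where
    open ≡-Reasoning
    x[1+j]≡ : x (+ suc j) ≡ x (+ 0) + + (L ℕ.+ suc k)
    x[1+j]≡ = begin
      x (+ suc j)                         ≡⟨ cong (x ∘ +_) (ℕ.+-comm 1 j) ⟩
      x (+ j + + 1)                       ≡⟨ next≡ ⟩
      x (+ j) + + suc k                   ≡⟨ cong (_+ + suc k) xj≡ ⟩
      x (+ 0) + + L + + suc k             ≡⟨ ℤ.+-assoc (x (+ 0)) (+ L) (+ suc k) ⟩
      x (+ 0) + + (L ℕ.+ suc k)           ∎
    count≡1+j : count X (x (+ 0)) (L ℕ.+ suc k) ≡ + suc j
    count≡1+j = begin
      count X (x (+ 0)) (L ℕ.+ suc k)                   ≡⟨ count-+ X (x (+ 0)) L (suc k) ⟩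
      count X (x (+ 0)) L + count X (x (+ 0) + + L) (suc k)
        ≡⟨ cong₂ (λ u v → u + count X v (suc k)) count≡j (sym xj≡) ⟩
      + j + count X (x (+ j)) (suc k)                   ≡⟨ cong (_+_ (+ j)) (count-gap (+ j) k next≡) ⟩
      + j + + 1                                          ≡⟨ cong +_ (ℕ.+-comm j 1) ⟩
      + suc j                                            ∎

  module _ (p n : ℕ) (X-periodic : ∀ z → X (z + + p) ≡ X z) (shift : ∀ i → x (i + + n) ≡ x i + + p) where

    count-period : ∀ z → count X z p ≡ + n
    count-period z with count-up-to n
    ... | L , xn≡ , count≡n = begin
      count X z p                                ≡⟨ count-shift z ⟩
      ∑[ k < p ] indicator (X (+ k))             ≡⟨ count-shift (x (+ 0)) ⟨
      count X (x (+ 0)) p                        ≡⟨ cong (count X (x (+ 0))) L≡p ⟨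
      count X (x (+ 0)) L                        ≡⟨ count≡n ⟩
      + n                                        ∎
      where
      open ≡-Reasoning
      count-shift : ∀ z → count X z p ≡ ∑[ k < p ] indicator (X (+ k))
      count-shift = ∑-periodic-shift (indicator ∘ X) p (cong indicator ∘ X-periodic)
      L≡p : L ≡ p
      L≡p = ℤ.+-injective (+-cancelˡ (x (+ 0)) (+ L) (+ p) (trans (sym xn≡) (shift (+ 0))))

    count-periods : ∀ z K → count X z (p ℕ.* K) ≡ + (K ℕ.* n)
    count-periods z zero    = cong (count X z) (ℕ.*-zeroʳ p)
    count-periods z (suc K) = begin
      count X z (p ℕ.* suc K)                      ≡⟨ cong (count X z) (ℕ.*-suc p K) ⟩
      count X z (p ℕ.+ p ℕ.* K)                    ≡⟨ count-+ X z p (p ℕ.* K) ⟩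
      count X z p + count X (z + + p) (p ℕ.* K)    ≡⟨ cong₂ _+_ (count-period z) (count-periods (z + + p) K) ⟩
      + n + + (K ℕ.* n)                            ≡⟨ ℤ.pos-+ n (K ℕ.* n) ⟨
      + (suc K ℕ.* n)                              ∎
      where open ≡-Reasoning

    countX-bound : ∀ N K → suc (2 ℕ.* N) ℕ.≤ p ℕ.* K → countX X N ℕ.≤ K ℕ.* n
    countX-bound N K 2N+1≤pK with ℕ.m≤n⇒∃[o]m+o≡n 2N+1≤pK
    ... | r , 2N+1+r≡pK = ℤ.drop‿+≤+ (begin
      + countX X N                              ≡⟨ countX-as-count X N ⟩
      count X (- + N) (suc (2 ℕ.* N))           ≤⟨ count-mono X (- + N) (suc (2 ℕ.* N)) r ⟩
      count X (- + N) (suc (2 ℕ.* N) ℕ.+ r)     ≡⟨ cong (count X (- + N)) 2N+1+r≡pK ⟩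
      count X (- + N) (p ℕ.* K)                 ≡⟨ count-periods (- + N) K ⟩
      + (K ℕ.* n)                               ∎)
      where open ℤ.≤-Reasoning

ceiling-multiple : ∀ p .{{_ : ℕ.NonZero p}} L → Σ ℕ λ K → (L ℕ.≤ p ℕ.* K) × (p ℕ.* K ℕ.≤ L ℕ.+ p)
ceiling-multiple p L = suc (L / p) , L≤ , ≤L+p
  where
  open ℕ.≤-Reasoning
  L≤ : L ℕ.≤ p ℕ.* suc (L / p)
  L≤ = begin
    L                         ≡⟨ m≡m%n+[m/n]*n L p ⟩
    L % p ℕ.+ L / p ℕ.* p     ≤⟨ ℕ.+-monoˡ-≤ (L / p ℕ.* p) (ℕ.<⇒≤ (m%n<n L p)) ⟩
    p ℕ.+ L / p ℕ.* p         ≡⟨ cong (p ℕ.+_) (ℕ.*-comm (L / p) p) ⟩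
    p ℕ.+ p ℕ.* (L / p)       ≡⟨ ℕ.*-suc p (L / p) ⟨
    p ℕ.* suc (L / p)         ∎
  ≤L+p : p ℕ.* suc (L / p) ℕ.≤ L ℕ.+ p
  ≤L+p = begin
    p ℕ.* suc (L / p)         ≡⟨ ℕ.*-suc p (L / p) ⟩
    p ℕ.+ p ℕ.* (L / p)       ≡⟨ ℕ.+-comm p _ ⟩
    p ℕ.* (L / p) ℕ.+ p       ≡⟨ cong (ℕ._+ p) (ℕ.*-comm p (L / p)) ⟩
    L / p ℕ.* p ℕ.+ p         ≤⟨ ℕ.+-monoˡ-≤ p (m/n*n≤m L p) ⟩
    L ℕ.+ p                   ∎

-- count / L ≤ A / B + e / D cross-multiplied: covering [-N, N] (of length L) by K
-- periods overshoots by at most one period, which costs A p / (B L) ≤ e / D.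
density-estimate : ∀ {count K n A B p D e L} → count ℕ.≤ K ℕ.* n → n ℕ.* B ℕ.≤ A ℕ.* p →
  p ℕ.* K ℕ.≤ L ℕ.+ p → A ℕ.* p ℕ.* D ℕ.≤ L → 1 ℕ.≤ e ℕ.* B →
  count ℕ.* (B ℕ.* D) ℕ.≤ (A ℕ.* D ℕ.+ e ℕ.* B) ℕ.* L
density-estimate {count} {K} {n} {A} {B} {p} {D} {e} {L} count≤Kn nB≤Ap pK≤L+p ApD≤L 1≤eB = begin
  count ℕ.* (B ℕ.* D)             ≤⟨ ℕ.*-monoˡ-≤ (B ℕ.* D) count≤Kn ⟩
  K ℕ.* n ℕ.* (B ℕ.* D)           ≡⟨ reassoc₁ K n B D ⟩
  K ℕ.* (n ℕ.* B) ℕ.* D           ≤⟨ ℕ.*-monoˡ-≤ D (ℕ.*-monoʳ-≤ K nB≤Ap) ⟩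
  K ℕ.* (A ℕ.* p) ℕ.* D           ≡⟨ reassoc₂ K A p D ⟩
  A ℕ.* D ℕ.* (p ℕ.* K)           ≤⟨ ℕ.*-monoʳ-≤ (A ℕ.* D) pK≤L+p ⟩
  A ℕ.* D ℕ.* (L ℕ.+ p)           ≡⟨ distrib A D L p ⟩
  A ℕ.* D ℕ.* L ℕ.+ A ℕ.* p ℕ.* D ≤⟨ ℕ.+-monoʳ-≤ (A ℕ.* D ℕ.* L) ApD≤L ⟩
  A ℕ.* D ℕ.* L ℕ.+ L             ≡⟨ cong (A ℕ.* D ℕ.* L ℕ.+_) (ℕ.*-identityˡ L) ⟨
  A ℕ.* D ℕ.* L ℕ.+ 1 ℕ.* L       ≤⟨ ℕ.+-monoʳ-≤ (A ℕ.* D ℕ.* L) (ℕ.*-monoˡ-≤ L 1≤eB) ⟩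
  A ℕ.* D ℕ.* L ℕ.+ e ℕ.* B ℕ.* L ≡⟨ ℕ.*-distribʳ-+ L (A ℕ.* D) (e ℕ.* B) ⟨
  (A ℕ.* D ℕ.+ e ℕ.* B) ℕ.* L     ∎
  where
  open ℕ.≤-Reasoning
  reassoc₁ : ∀ K n B D → K ℕ.* n ℕ.* (B ℕ.* D) ≡ K ℕ.* (n ℕ.* B) ℕ.* D
  reassoc₁ = ℕ-solve-∀
  reassoc₂ : ∀ K A p D → K ℕ.* (A ℕ.* p) ℕ.* D ≡ A ℕ.* D ℕ.* (p ℕ.* K)
  reassoc₂ = ℕ-solve-∀
  distrib : ∀ A D L p → A ℕ.* D ℕ.* (L ℕ.+ p) ≡ A ℕ.* D ℕ.* L ℕ.+ A ℕ.* p ℕ.* D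
  distrib = ℕ-solve-∀

/ℕ-≤-/ℕ-+ : ∀ c L A B e D (ε : ℚ) → ℚ.↥ ε ≡ + suc e → ℚ.↧ ε ≡ + suc D →
  c ℕ.* (suc B ℕ.* suc D) ℕ.≤ (A ℕ.* suc D ℕ.+ suc e ℕ.* suc B) ℕ.* suc L →
  (c /ℕ suc L) ℚ.≤ (A /ℕ suc B) ℚ.+ ε
/ℕ-≤-/ℕ-+ c L A B e D ε@(mkℚ _ _ _) refl refl cross = ℚ.toℚᵘ-cancel-≤ (begin
  ℚ.toℚᵘ (c /ℕ suc L)                  ≃⟨ ℚ.toℚᵘ-fromℚᵘ (ℚᵘ.mkℚᵘ (+ c) L) ⟩
  ℚᵘ.mkℚᵘ (+ c) L                       ≤⟨ ℚᵘ.*≤* cross-ℤ ⟩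
  ℚᵘ.mkℚᵘ (+ A) B ℚᵘ.+ ℚ.toℚᵘ ε         ≃⟨ ℚᵘ.+-cong (ℚ.toℚᵘ-fromℚᵘ (ℚᵘ.mkℚᵘ (+ A) B)) ℚᵘ.≃-refl ⟨
  ℚ.toℚᵘ (A /ℕ suc B) ℚᵘ.+ ℚ.toℚᵘ ε     ≃⟨ ℚ.toℚᵘ-homo-+ (A /ℕ suc B) ε ⟨
  ℚ.toℚᵘ ((A /ℕ suc B) ℚ.+ ε)           ∎)
  where
  open ℚᵘ.≤-Reasoning
  cross-ℤ : + c * + (suc B ℕ.* suc D) ≤ (+ A * + suc D + + suc e * + suc B) * + suc L
  cross-ℤ = subst₂ _≤_ (ℤ.pos-* c _)
    (trans (ℤ.pos-* (A ℕ.* suc D ℕ.+ suc e ℕ.* suc B) (suc L))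
           (cong (_* + suc L) (trans (ℤ.pos-+ (A ℕ.* suc D) _)
                                     (cong₂ _+_ (ℤ.pos-* A (suc D)) (ℤ.pos-* (suc e) (suc B))))))
    (ℤ.+≤+ cross)

density-bound : ∀ X A B n p .{{_ : ℕ.NonZero B}} .{{_ : ℕ.NonZero p}} → n ℕ.* B ℕ.≤ A ℕ.* p →
  (∀ N K → suc (2 ℕ.* N) ℕ.≤ p ℕ.* K → countX X N ℕ.≤ K ℕ.* n) → DensityAtMost X (A /ℕ B)
density-bound X A (suc B) n p nB≤Ap countX≤ ε@(mkℚ ℤ.+[1+ e ] D _) _ = A ℕ.* p ℕ.* suc D , eventually
  where
  eventually : ∀ N → A ℕ.* p ℕ.* suc D ℕ.≤ N →
    (countX X N /ℕ suc (2 ℕ.* N)) ℚ.≤ (A /ℕ suc B) ℚ.+ ε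
  eventually N N₀≤N with ceiling-multiple p (suc (2 ℕ.* N))
  ... | K , 2N+1≤pK , pK≤2N+1+p = /ℕ-≤-/ℕ-+ (countX X N) (2 ℕ.* N) A B e D ε refl refl
    (density-estimate {A = A} {e = suc e} (countX≤ N K 2N+1≤pK) nB≤Ap pK≤2N+1+p
      (ℕ.≤-trans N₀≤N (ℕ.≤-trans (ℕ.m≤m+n N (N ℕ.+ 0)) (ℕ.n≤1+n _))) (ℕ.s≤s ℕ.z≤n))
density-bound X A (suc B) n p nB≤Ap countX≤ (mkℚ (+ zero) _ _) ()
density-bound X A (suc B) n p nB≤Ap countX≤ (mkℚ -[1+ _ ] _ _) ()

lemma21 : (S : List ℕ) → FinPosSet S →
    (a b t c : ℕ) → 1 ℕ.≤ a → 1 ℕ.≤ b → 1 ℕ.≤ t →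
    (X : Subsetℤ) → NonemptySet X → Periodic X → IndependentIn S X →
    (x : ℤ → ℤ) → IncreasingIndexing X x →
    (d : ℤ → ℤ → ℤ) → Antisymmetric d → (m : ℕ) → LocalFirstStage x d m →
    (d' : ℤ → ℤ → ℤ) → Antisymmetric d' → (m' : ℕ) → LocalSecondStage x t d' m' →
    (∀ j → + c ℤ.≤ ν' a b t x d m d' m' j) →
    DensityAtMost X ((a ℕ.* t) /ℕ (b ℕ.* t ℕ.+ c))
lemma21 _ _ a b t c _ (ℕ.s≤s ℕ.z≤n) (ℕ.s≤s ℕ.z≤n) X _ (p , ℕ.s≤s ℕ.z≤n , X-periodic) _
        x x-indexes-X d d-anti m d-local d' d'-anti m' d'-local c≤ν'
  with index-period x-indexes-X p X-periodic
... | n , shift = density-bound X (a ℕ.* t) (b ℕ.* t ℕ.+ c) n p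
  (Charges.period-charge-bound a b t d d-anti m d-local d' d'-anti m' d'-local c c≤ν')
  (countX-bound p n X-periodic shift)
  where
  open PeriodicBlocks x n p shift
  open Counting x-indexes-X
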